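{- For $n\geq 0$ let $A_n$ be the number of tilings of the $3\times n$ board (3 rows, $n$ columns) using unit squares and L-triominoes, where every L-triomino is a translate of the fixed shape consisting of the cells $(0,0),(1,0),(0,1)$ (column, row), i.e.\ two cells in its bottom row and one cell above the left one (no rotations or reflections allowed). Then \[ A_n=A_{n-1}+2A_{n-2}+A_{n-3}\quad(n\geq 3),\qquad A_0=1,\ A_1=1,\ A_2=3. \] -}

module Defs where

open import Data.Nat using (ℕ; zero; suc; _+_; _*_; _≡ᵇ_; _<ᵇ_)
open import Data.Bool using (Bool; true; false; _∧_; if_then_else_)
open import Data.List using (List; []; _∷_; _++_; map; concatMap; filter; length; upTo)
open import Data.Bool.ListAction using (any; all)
open import Data.Product using (_×_; _,_)
open import Relation.Nullary.Decidable using (yes; no)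
open import Relation.Binary.PropositionalEquality using (_≡_)
open import Data.Bool.Properties using (_≟_)

-- A cell of the board: (column , row).
Cell : Set
Cell = ℕ × ℕ

cellEq : Cell → Cell → Bool
cellEq (a , b) (c , d) = (a ≡ᵇ c) ∧ (b ≡ᵇ d)

board : ℕ → List Cell
board n = concatMap (λ c → map (λ r → (c , r)) (upTo 3)) (upTo n)

Tile : Set
Tile = List Cell

squares : ℕ → List Tile
squares n = map (λ x → x ∷ []) (board n)

lShape : Cell → Tile
lShape (c , r) = (c , r) ∷ (suc c , r) ∷ (c , suc r) ∷ []

ells : ℕ → List Tile
ells n = map lShape (filter (λ { (c , r) → (suc c <ᵇ n) Data.Bool.≟ true })
                            (concatMap (λ c → map (λ r → (c , r)) (upTo 2)) (upTo n)))

placements : ℕ → List Tile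
placements n = squares n ++ ells n

sublists : {A : Set} → List A → List (List A)
sublists [] = [] ∷ []
sublists (x ∷ xs) = let s = sublists xs in s ++ map (x ∷_) s

coverCount : List Tile → Cell → ℕ
coverCount S x = length (filter (λ t → any (cellEq x) t ≟ true) S)

-- A selection of placements is a tiling iff every board cell is covered
-- exactly once (all placements lie inside the board).
isTiling : ℕ → List Tile → Bool
isTiling n S = all (λ x → coverCount S x ≡ᵇ 1) (board n)

A : ℕ → ℕ
A n = length (filter (λ S → isTiling n S ≟ true) (sublists (placements n)))

-- Cut a tiling after its first column. The tiles meeting column 0 are among the three squares
-- and the two L-triominoes anchored there; the other tiles, moved one column to the left, tile
-- the shorter board, except that the L-triominoes of column 0 already cover its cells (0,0)
-- and/or (0,1). So count more generally the tilings T m a b of the 3 × m board whose cells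
-- (0,0) and (0,1) are covered a and b times in advance. Filling the first column gives, for m ≥ 1,
--   T (m+1) 0 0 = T m 0 0 + T m 1 0 + T m 0 1,  T (m+1) 1 0 = T m 0 0 + T m 0 1,  T (m+1) 0 1 = T m 0 0,
-- and with A m = T m 0 0 this is the recurrence. Since A counts sub-selections of a list of
-- placements and being a tiling only depends on how often each cell is covered, that list may
-- be permuted to put the column-0 tiles first, and the count then splits over this first block.

module Submission where

open import Defs
open import Data.Nat using (ℕ; zero; suc; _+_; _*_; _≡ᵇ_; _<ᵇ_)
open import Data.Nat.Properties using (+-assoc; +-identityʳ; +-commutativeSemigroup)
open import Algebra.Properties.CommutativeSemigroup +-commutativeSemigroup using (interchange)
open import Data.Bool using (Bool; true; false; _∧_; if_then_else_)
open import Data.Bool.ListAction using (all; any; and; or)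
open import Data.Bool.Properties using (_≟_; ∧-assoc)
open import Data.List using (List; []; _∷_; [_]; _++_; map; concatMap; filter; length; upTo; applyUpTo)
open import Data.List.Properties using (filter-++; length-++; map-++; map-∘; map-cong-local; map-upTo; concatMap-map; concatMap-cong; map-concatMap)
open import Data.List.Relation.Unary.All using (All; []; _∷_; universal)
open import Data.List.Relation.Binary.Permutation.Propositional using (_↭_; refl; prep; swap; trans; module PermutationReasoning)
open import Data.List.Relation.Binary.Permutation.Propositional.Properties using (filter-↭; ↭-length; ++⁺ˡ; shifts) renaming (++-assoc to ↭-++-assoc)
open import Data.Product using (_×_; _,_)
open import Function using (_∘_)
open import Relation.Nullary using (Dec)
open import Data.Nat.Tactic.RingSolver using (solve-∀)
open import Relation.Binary.PropositionalEquality as ≡ using (_≡_; refl; sym; cong; cong₂; module ≡-Reasoning)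

variable
  X Y : Set

toℕ : Bool → ℕ
toℕ true = 1
toℕ false = 0

count : (X → Bool) → List X → ℕ
count p xs = length (filter (λ x → p x ≟ true) xs)

count-∷ : (p : X → Bool) (x : X) (xs : List X) → count p (x ∷ xs) ≡ toℕ (p x) + count p xs
count-∷ p x xs with p x
... | true  = refl
... | false = refl

count-++ : (p : X → Bool) (xs ys : List X) → count p (xs ++ ys) ≡ count p xs + count p ys
count-++ p xs ys = ≡.trans (cong length (filter-++ _ xs ys)) (length-++ (filter _ xs))

count-map : {p : X → Bool} {q : Y → Bool} (f : X → Y) → (∀ x → q (f x) ≡ p x) →
            (xs : List X) → count q (map f xs) ≡ count p xs
count-map f e []       = refl
count-map {p = p} {q} f e (x ∷ xs) = begin
  count q (f x ∷ map f xs)           ≡⟨ count-∷ q (f x) (map f xs) ⟩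
  toℕ (q (f x)) + count q (map f xs) ≡⟨ cong₂ _+_ (cong toℕ (e x)) (count-map f e xs) ⟩
  toℕ (p x) + count p xs             ≡⟨ count-∷ p x xs ⟨
  count p (x ∷ xs)                   ∎
  where open ≡-Reasoning

count-↭ : (p : X → Bool) {xs ys : List X} → xs ↭ ys → count p xs ≡ count p ys
count-↭ p xs↭ys = ↭-length (filter-↭ (λ x → p x ≟ true) xs↭ys)

Σ⊆ : List X → (List X → ℕ) → ℕ
Σ⊆ []       g = g []
Σ⊆ (x ∷ xs) g = Σ⊆ xs g + Σ⊆ xs (g ∘ (x ∷_))

count-sublists : (p : List X → Bool) (xs : List X) → count p (sublists xs) ≡ Σ⊆ xs (toℕ ∘ p)
count-sublists p []       = ≡.trans (count-∷ p [] []) (+-identityʳ _)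
count-sublists p (x ∷ xs) = begin
  count p (sublists xs ++ map (x ∷_) (sublists xs))
    ≡⟨ count-++ p (sublists xs) _ ⟩
  count p (sublists xs) + count p (map (x ∷_) (sublists xs))
    ≡⟨ cong (count p (sublists xs) +_) (count-map (x ∷_) (λ _ → refl) (sublists xs)) ⟩
  count p (sublists xs) + count (p ∘ (x ∷_)) (sublists xs)
    ≡⟨ cong₂ _+_ (count-sublists p xs) (count-sublists (p ∘ (x ∷_)) xs) ⟩
  Σ⊆ xs (toℕ ∘ p) + Σ⊆ xs (toℕ ∘ p ∘ (x ∷_)) ∎
  where open ≡-Reasoning

Σ⊆-cong : {g h : List X → ℕ} (xs : List X) → (∀ s → g s ≡ h s) → Σ⊆ xs g ≡ Σ⊆ xs h
Σ⊆-cong []       e = e []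
Σ⊆-cong (x ∷ xs) e = cong₂ _+_ (Σ⊆-cong xs e) (Σ⊆-cong xs (e ∘ (x ∷_)))

Σ⊆-congᴬ : {P : X → Set} {g h : List X → ℕ} {xs : List X} → All P xs →
           (∀ s → All P s → g s ≡ h s) → Σ⊆ xs g ≡ Σ⊆ xs h
Σ⊆-congᴬ []         e = e [] []
Σ⊆-congᴬ (px ∷ pxs) e = cong₂ _+_ (Σ⊆-congᴬ pxs e) (Σ⊆-congᴬ pxs (λ s ps → e _ (px ∷ ps)))

Σ⊆-zero : (xs : List X) → Σ⊆ xs (λ _ → 0) ≡ 0
Σ⊆-zero []       = refl
Σ⊆-zero (x ∷ xs) = cong₂ _+_ (Σ⊆-zero xs) (Σ⊆-zero xs)

Σ⊆-∧ : (c : Bool) (p : List X → Bool) (xs : List X) →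
       Σ⊆ xs (λ s → toℕ (c ∧ p s)) ≡ (if c then Σ⊆ xs (toℕ ∘ p) else 0)
Σ⊆-∧ true  p xs = refl
Σ⊆-∧ false p xs = Σ⊆-zero xs

Σ⊆-++ : (xs ys : List X) (g : List X → ℕ) → Σ⊆ (xs ++ ys) g ≡ Σ⊆ xs (λ s → Σ⊆ ys (g ∘ (s ++_)))
Σ⊆-++ []       ys g = refl
Σ⊆-++ (x ∷ xs) ys g = cong₂ _+_ (Σ⊆-++ xs ys g) (Σ⊆-++ xs ys (g ∘ (x ∷_)))

Σ⊆-map : (f : X → Y) (xs : List X) (g : List Y → ℕ) → Σ⊆ (map f xs) g ≡ Σ⊆ xs (g ∘ map f)
Σ⊆-map f []       g = refl
Σ⊆-map f (x ∷ xs) g = cong₂ _+_ (Σ⊆-map f xs g) (Σ⊆-map f xs (g ∘ (f x ∷_)))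

Σ⊆-↭ : {g h : List X → ℕ} {xs ys : List X} → xs ↭ ys →
       (∀ {s t} → s ↭ t → g s ≡ h t) → Σ⊆ xs g ≡ Σ⊆ ys h
Σ⊆-↭ {xs = xs} refl      g↭h = Σ⊆-cong xs (λ s → g↭h refl)
Σ⊆-↭ (prep x p)          g↭h = cong₂ _+_ (Σ⊆-↭ p g↭h) (Σ⊆-↭ p (g↭h ∘ prep x))
Σ⊆-↭ {g = g} {xs = x ∷ y ∷ xs} (swap x y p) g↭h =
  ≡.trans (interchange (Σ⊆ xs g) (Σ⊆ xs (g ∘ (y ∷_))) (Σ⊆ xs (g ∘ (x ∷_))) (Σ⊆ xs (g ∘ (x ∷_) ∘ (y ∷_))))
          (cong₂ _+_ (cong₂ _+_ (Σ⊆-↭ p g↭h) (Σ⊆-↭ p (g↭h ∘ prep x)))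
                     (cong₂ _+_ (Σ⊆-↭ p (g↭h ∘ prep y)) (Σ⊆-↭ p (g↭h ∘ swap x y))))
Σ⊆-↭ (trans p q)         g↭h =
  ≡.trans (Σ⊆-↭ p g↭h) (Σ⊆-↭ q (λ s↭t → ≡.trans (sym (g↭h refl)) (g↭h s↭t)))

all-++ : (p : X → Bool) (xs ys : List X) → all p (xs ++ ys) ≡ all p xs ∧ all p ys
all-++ p []       ys = refl
all-++ p (x ∷ xs) ys = ≡.trans (cong (p x ∧_) (all-++ p xs ys)) (sym (∧-assoc (p x) _ _))

all-map : (p : Y → Bool) (f : X → Y) (xs : List X) → all p (map f xs) ≡ all (p ∘ f) xs
all-map p f xs = cong and (sym (map-∘ xs))

all-cong : {p q : X → Bool} {xs : List X} → All (λ x → p x ≡ q x) xs → all p xs ≡ all q xs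
all-cong e = cong and (map-cong-local e)

shift : Cell → Cell
shift (c , r) = (suc c , r)

shiftTile : Tile → Tile
shiftTile = map shift

grid : List ℕ → ℕ → List Cell
grid rows m = concatMap (λ c → map (c ,_) rows) (upTo m)

grid-suc : (rows : List ℕ) (m : ℕ) → grid rows (suc m) ≡ map (0 ,_) rows ++ map shift (grid rows m)
grid-suc rows m = cong (map (0 ,_) rows ++_) (begin
  concatMap column (applyUpTo suc m)      ≡⟨ cong (concatMap column) (map-upTo suc m) ⟨
  concatMap column (map suc (upTo m))     ≡⟨ concatMap-map column suc (upTo m) ⟩
  concatMap (column ∘ suc) (upTo m)       ≡⟨ concatMap-cong (λ c → map-∘ rows) (upTo m) ⟩
  concatMap (map shift ∘ column) (upTo m) ≡⟨ map-concatMap shift column (upTo m) ⟨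
  map shift (grid rows m)                 ∎)
  where
  open ≡-Reasoning
  column : ℕ → List Cell
  column c = map (c ,_) rows

column₀ : List Cell
column₀ = map (0 ,_) (upTo 3)

board-suc : (m : ℕ) → board (suc m) ≡ column₀ ++ map shift (board m)
board-suc = grid-suc (upTo 3)

column₀Tiles : List Tile
column₀Tiles = map [_] column₀ ++ lShape (0 , 0) ∷ lShape (0 , 1) ∷ []

anchorFits : ℕ → Cell → Bool
anchorFits n (c , r) = suc c <ᵇ n

filter-anchorFits-shift : (n : ℕ) (xs : List Cell) →
  filter (λ x → anchorFits (suc n) x ≟ true) (map shift xs)
    ≡ map shift (filter (λ x → anchorFits n x ≟ true) xs)
filter-anchorFits-shift n []       = refl
filter-anchorFits-shift n (x ∷ xs) with anchorFits n x
... | true  = cong (shift x ∷_) (filter-anchorFits-shift n xs)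
... | false = filter-anchorFits-shift n xs

ells-suc : (n : ℕ) → ells (2 + n) ≡ lShape (0 , 0) ∷ lShape (0 , 1) ∷ map shiftTile (ells (1 + n))
ells-suc n = begin
  ells (2 + n)
    ≡⟨ cong (map lShape ∘ filter (fits (2 + n))) (grid-suc (upTo 2) (1 + n)) ⟩
  lShape (0 , 0) ∷ lShape (0 , 1) ∷ map lShape (filter (fits (2 + n)) (map shift anchors))
    ≡⟨ cong (λ xs → lShape (0 , 0) ∷ lShape (0 , 1) ∷ map lShape xs) (filter-anchorFits-shift (1 + n) anchors) ⟩
  lShape (0 , 0) ∷ lShape (0 , 1) ∷ map lShape (map shift (filter (fits (1 + n)) anchors))
    ≡⟨ cong (λ xs → lShape (0 , 0) ∷ lShape (0 , 1) ∷ xs) (≡.trans (sym (map-∘ _)) (map-∘ _)) ⟩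
  lShape (0 , 0) ∷ lShape (0 , 1) ∷ map shiftTile (ells (1 + n)) ∎
  where
  open ≡-Reasoning
  fits : (m : ℕ) (x : Cell) → Dec (anchorFits m x ≡ true)
  fits m x = anchorFits m x ≟ true
  anchors : List Cell
  anchors = grid (upTo 2) (1 + n)

squares-suc : (m : ℕ) → squares (suc m) ≡ map [_] column₀ ++ map shiftTile (squares m)
squares-suc m = begin
  map [_] (board (suc m))
    ≡⟨ cong (map [_]) (board-suc m) ⟩
  map [_] (column₀ ++ map shift (board m))
    ≡⟨ map-++ [_] column₀ (map shift (board m)) ⟩
  map [_] column₀ ++ map [_] (map shift (board m))
    ≡⟨ cong (map [_] column₀ ++_) (≡.trans (sym (map-∘ _)) (map-∘ _)) ⟩
  map [_] column₀ ++ map shiftTile (squares m) ∎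
  where open ≡-Reasoning

placements-↭ : (n : ℕ) → placements (2 + n) ↭ column₀Tiles ++ map shiftTile (placements (1 + n))
placements-↭ n = begin
  squares (2 + n) ++ ells (2 + n)
    ≡⟨ cong₂ _++_ (squares-suc (1 + n)) (ells-suc n) ⟩
  (map [_] column₀ ++ map shiftTile sq) ++ (ells₀ ++ map shiftTile el)
    ↭⟨ ↭-++-assoc (map [_] column₀) (map shiftTile sq) (ells₀ ++ map shiftTile el) ⟩
  map [_] column₀ ++ map shiftTile sq ++ ells₀ ++ map shiftTile el
    ↭⟨ ++⁺ˡ (map [_] column₀) (shifts (map shiftTile sq) ells₀) ⟩
  map [_] column₀ ++ ells₀ ++ map shiftTile sq ++ map shiftTile el
    ↭⟨ ↭-++-assoc (map [_] column₀) ells₀ (map shiftTile sq ++ map shiftTile el) ⟨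
  column₀Tiles ++ map shiftTile sq ++ map shiftTile el
    ≡⟨ cong (column₀Tiles ++_) (map-++ shiftTile sq el) ⟨
  column₀Tiles ++ map shiftTile (placements (1 + n)) ∎
  where
  open PermutationReasoning
  sq el ells₀ : List Tile
  sq = squares (1 + n)
  el = ells (1 + n)
  ells₀ = lShape (0 , 0) ∷ lShape (0 , 1) ∷ []

coverCount-++ : (S T : List Tile) (x : Cell) → coverCount (S ++ T) x ≡ coverCount S x + coverCount T x
coverCount-++ S T x = count-++ (any (cellEq x)) S T

coverCount-↭ : {S T : List Tile} → S ↭ T → (x : Cell) → coverCount S x ≡ coverCount T x
coverCount-↭ S↭T x = count-↭ (any (cellEq x)) S↭T

coverCount-shift : (S : List Tile) (x : Cell) → coverCount (map shiftTile S) (shift x) ≡ coverCount S x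
coverCount-shift S x = count-map shiftTile (λ t → cong or (sym (map-∘ t))) S

shiftTile-misses-column₀ : (r : ℕ) (t : Tile) → any (cellEq (0 , r)) (shiftTile t) ≡ false
shiftTile-misses-column₀ r []      = refl
shiftTile-misses-column₀ r (_ ∷ t) = shiftTile-misses-column₀ r t

coverCount-shift-column₀ : (S : List Tile) (r : ℕ) → coverCount (map shiftTile S) (0 , r) ≡ 0
coverCount-shift-column₀ []      r = refl
coverCount-shift-column₀ (t ∷ S) r =
  ≡.trans (count-∷ (any (cellEq (0 , r))) (shiftTile t) (map shiftTile S))
          (cong₂ _+_ (cong toℕ (shiftTile-misses-column₀ r t)) (coverCount-shift-column₀ S r))

exactCover : (Cell → ℕ) → List Cell → List Tile → Bool
exactCover ι cells S = all (λ x → ι x + coverCount S x ≡ᵇ 1) cells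

exactCover-↭ : (ι : Cell → ℕ) (cells : List Cell) {S T : List Tile} → S ↭ T →
               exactCover ι cells S ≡ exactCover ι cells T
exactCover-↭ ι cells S↭T = all-cong (universal (λ x → cong (λ k → ι x + k ≡ᵇ 1) (coverCount-↭ S↭T x)) cells)

tilings : ℕ → (Cell → ℕ) → ℕ
tilings m ι = Σ⊆ (placements m) (toℕ ∘ exactCover ι (board m))

tilings-cong : (m : ℕ) {ι κ : Cell → ℕ} → (∀ x → ι x ≡ κ x) → tilings m ι ≡ tilings m κ
tilings-cong m e = Σ⊆-cong (placements m) (λ S →
  cong toℕ (all-cong (universal (λ x → cong (λ k → k + coverCount S x ≡ᵇ 1) (e x)) (board m))))

inflowAfter : (Cell → ℕ) → List Tile → Cell → ℕ
inflowAfter ι s x = ι (shift x) + coverCount s (shift x)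

exactCover-split : (ι : Cell → ℕ) (m : ℕ) (s S : List Tile) →
  exactCover ι (board (suc m)) (s ++ map shiftTile S)
    ≡ exactCover ι column₀ s ∧ exactCover (inflowAfter ι s) (board m) S
exactCover-split ι m s S = begin
  all p (board (suc m))                       ≡⟨ cong (all p) (board-suc m) ⟩
  all p (column₀ ++ map shift (board m))      ≡⟨ all-++ p column₀ (map shift (board m)) ⟩
  all p column₀ ∧ all p (map shift (board m)) ≡⟨ cong (all p column₀ ∧_) (all-map p shift (board m)) ⟩
  all p column₀ ∧ all (p ∘ shift) (board m)   ≡⟨ cong₂ _∧_ in-column₀ (all-cong (universal beyond-column₀ (board m))) ⟩
  exactCover ι column₀ s ∧ exactCover (inflowAfter ι s) (board m) S ∎
  where
  open ≡-Reasoning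
  p : Cell → Bool
  p x = ι x + coverCount (s ++ map shiftTile S) x ≡ᵇ 1
  at-column₀ : ∀ r → p (0 , r) ≡ (ι (0 , r) + coverCount s (0 , r) ≡ᵇ 1)
  at-column₀ r = cong (λ k → ι (0 , r) + k ≡ᵇ 1) (begin
    coverCount (s ++ map shiftTile S) (0 , r)
      ≡⟨ coverCount-++ s (map shiftTile S) (0 , r) ⟩
    coverCount s (0 , r) + coverCount (map shiftTile S) (0 , r)
      ≡⟨ cong (coverCount s (0 , r) +_) (coverCount-shift-column₀ S r) ⟩
    coverCount s (0 , r) + 0
      ≡⟨ +-identityʳ _ ⟩
    coverCount s (0 , r) ∎)
  in-column₀ : all p column₀ ≡ exactCover ι column₀ s
  in-column₀ = all-cong {p = p} {q = λ x → ι x + coverCount s x ≡ᵇ 1}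
                        (at-column₀ 0 ∷ at-column₀ 1 ∷ at-column₀ 2 ∷ [])
  beyond-column₀ : ∀ x → p (shift x) ≡ (inflowAfter ι s x + coverCount S x ≡ᵇ 1)
  beyond-column₀ x = cong (_≡ᵇ 1) (begin
    ι (shift x) + coverCount (s ++ map shiftTile S) (shift x)
      ≡⟨ cong (ι (shift x) +_) (coverCount-++ s (map shiftTile S) (shift x)) ⟩
    ι (shift x) + (coverCount s (shift x) + coverCount (map shiftTile S) (shift x))
      ≡⟨ cong (λ k → ι (shift x) + (coverCount s (shift x) + k)) (coverCount-shift S x) ⟩
    ι (shift x) + (coverCount s (shift x) + coverCount S x)
      ≡⟨ +-assoc (ι (shift x)) _ _ ⟨
    (ι (shift x) + coverCount s (shift x)) + coverCount S x ∎)

tilings-split-column₀ : (n : ℕ) (ι : Cell → ℕ) → tilings (2 + n) ι ≡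
  Σ⊆ column₀Tiles (λ s → if exactCover ι column₀ s then tilings (1 + n) (inflowAfter ι s) else 0)
tilings-split-column₀ n ι = begin
  Σ⊆ (placements (2 + n)) covers
    ≡⟨ Σ⊆-↭ (placements-↭ n) (cong toℕ ∘ exactCover-↭ ι (board (2 + n))) ⟩
  Σ⊆ (column₀Tiles ++ map shiftTile rest) covers
    ≡⟨ Σ⊆-++ column₀Tiles (map shiftTile rest) covers ⟩
  Σ⊆ column₀Tiles (λ s → Σ⊆ (map shiftTile rest) (covers ∘ (s ++_)))
    ≡⟨ Σ⊆-cong column₀Tiles peel ⟩
  Σ⊆ column₀Tiles (λ s → if exactCover ι column₀ s then tilings (1 + n) (inflowAfter ι s) else 0) ∎
  where
  open ≡-Reasoning
  covers : List Tile → ℕ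
  covers = toℕ ∘ exactCover ι (board (2 + n))
  rest : List Tile
  rest = placements (1 + n)
  peel : ∀ s → Σ⊆ (map shiftTile rest) (covers ∘ (s ++_))
             ≡ (if exactCover ι column₀ s then tilings (1 + n) (inflowAfter ι s) else 0)
  peel s = begin
    Σ⊆ (map shiftTile rest) (covers ∘ (s ++_))
      ≡⟨ Σ⊆-map shiftTile rest (covers ∘ (s ++_)) ⟩
    Σ⊆ rest (λ S → toℕ (exactCover ι (board (2 + n)) (s ++ map shiftTile S)))
      ≡⟨ Σ⊆-cong rest (λ S → cong toℕ (exactCover-split ι (1 + n) s S)) ⟩
    Σ⊆ rest (λ S → toℕ (exactCover ι column₀ s ∧ exactCover (inflowAfter ι s) (board (1 + n)) S))
      ≡⟨ Σ⊆-∧ (exactCover ι column₀ s) (exactCover (inflowAfter ι s) (board (1 + n))) rest ⟩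
    (if exactCover ι column₀ s then tilings (1 + n) (inflowAfter ι s) else 0) ∎

-- Cells (0 , 0) and (0 , 1) already covered a and b times by L-triominoes from the column to the left.
inflow : ℕ → ℕ → Cell → ℕ
inflow a b (zero , zero)     = a
inflow a b (zero , suc zero) = b
inflow a b _                 = 0

inflow-zero : (x : Cell) → inflow 0 0 x ≡ 0
inflow-zero (zero , zero)        = refl
inflow-zero (zero , suc zero)    = refl
inflow-zero (zero , suc (suc r)) = refl
inflow-zero (suc c , r)          = refl

inflow-+ : (a b a′ b′ : ℕ) (x : Cell) → inflow (a + a′) (b + b′) x ≡ inflow a b x + inflow a′ b′ x
inflow-+ a b a′ b′ (zero , zero)        = refl
inflow-+ a b a′ b′ (zero , suc zero)    = refl
inflow-+ a b a′ b′ (zero , suc (suc r)) = refl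
inflow-+ a b a′ b′ (suc c , r)          = refl

tilingsWith : ℕ → ℕ → ℕ → ℕ
tilingsWith m a b = tilings m (inflow a b)

-- isTiling m is exactCover (λ _ → 0) (board m) by computation, as 0 + k reduces to k.
A-tilingsWith : (m : ℕ) → A m ≡ tilingsWith m 0 0
A-tilingsWith m = ≡.trans (count-sublists (isTiling m) (placements m)) (tilings-cong m (sym ∘ inflow-zero))

OverhangRows₀₁ : List Tile → Set
OverhangRows₀₁ s = ∀ x → coverCount s (shift x) ≡ inflow (coverCount s (1 , 0)) (coverCount s (1 , 1)) x

overhangRows₀₁-++ : {s t : List Tile} → OverhangRows₀₁ s → OverhangRows₀₁ t → OverhangRows₀₁ (s ++ t)
overhangRows₀₁-++ {s} {t} os ot x = begin
  coverCount (s ++ t) (shift x)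
    ≡⟨ coverCount-++ s t (shift x) ⟩
  coverCount s (shift x) + coverCount t (shift x)
    ≡⟨ cong₂ _+_ (os x) (ot x) ⟩
  inflow (coverCount s (1 , 0)) (coverCount s (1 , 1)) x + inflow (coverCount t (1 , 0)) (coverCount t (1 , 1)) x
    ≡⟨ inflow-+ _ _ _ _ x ⟨
  inflow (coverCount s (1 , 0) + coverCount t (1 , 0)) (coverCount s (1 , 1) + coverCount t (1 , 1)) x
    ≡⟨ cong₂ (λ a b → inflow a b x) (coverCount-++ s t (1 , 0)) (coverCount-++ s t (1 , 1)) ⟨
  inflow (coverCount (s ++ t) (1 , 0)) (coverCount (s ++ t) (1 , 1)) x ∎
  where open ≡-Reasoning

overhangRows₀₁-All : {s : List Tile} → All (OverhangRows₀₁ ∘ [_]) s → OverhangRows₀₁ s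
overhangRows₀₁-All []                 = sym ∘ inflow-zero
overhangRows₀₁-All {t ∷ s} (ot ∷ ots) = overhangRows₀₁-++ {[ t ]} {s} ot (overhangRows₀₁-All ots)

column₀Tiles-overhangRows₀₁ : All (OverhangRows₀₁ ∘ [_]) column₀Tiles
column₀Tiles-overhangRows₀₁ = square ∷ square ∷ square ∷ ell₀ ∷ ell₁ ∷ []
  where
  square : ∀ x → 0 ≡ inflow 0 0 x
  square = sym ∘ inflow-zero
  ell₀ : OverhangRows₀₁ [ lShape (0 , 0) ]
  ell₀ (zero , zero)        = refl
  ell₀ (zero , suc zero)    = refl
  ell₀ (zero , suc (suc r)) = refl
  ell₀ (suc c , r)          = refl
  ell₁ : OverhangRows₀₁ [ lShape (0 , 1) ]
  ell₁ (zero , zero)        = refl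
  ell₁ (zero , suc zero)    = refl
  ell₁ (zero , suc (suc r)) = refl
  ell₁ (suc c , r)          = refl

transfer : ℕ → ℕ → (ℕ → ℕ → ℕ) → ℕ
transfer a b F = Σ⊆ column₀Tiles (λ s →
  if exactCover (inflow a b) column₀ s then F (coverCount s (1 , 0)) (coverCount s (1 , 1)) else 0)

tilingsWith-transfer : (n a b : ℕ) → tilingsWith (2 + n) a b ≡ transfer a b (tilingsWith (1 + n))
tilingsWith-transfer n a b = ≡.trans (tilings-split-column₀ n (inflow a b))
  (Σ⊆-congᴬ column₀Tiles-overhangRows₀₁ (λ s os →
    cong (λ k → if exactCover (inflow a b) column₀ s then k else 0)
         (tilings-cong (1 + n) (overhangRows₀₁-All os))))

-- transfer a b F computes to a sum over the 2⁵ sub-selections of column₀Tiles, whose normal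
-- form is the left-hand side of rearrange. For a = b = 0 the surviving selections are the three
-- squares, L (0 , 0) with the square (0 , 2), and the square (0 , 0) with L (0 , 1).
transfer-00 : (F : ℕ → ℕ → ℕ) → transfer 0 0 F ≡ F 0 0 + F 1 0 + F 0 1
transfer-00 F = rearrange (F 0 0) (F 1 0) (F 0 1)
  where
  rearrange : ∀ x y z → y + 0 + 0 + (z + 0 + 0 + (x + 0 + 0)) ≡ x + y + z
  rearrange = solve-∀

transfer-10 : (F : ℕ → ℕ → ℕ) → transfer 1 0 F ≡ F 0 0 + F 0 1
transfer-10 F = rearrange (F 0 0) (F 0 1)
  where
  rearrange : ∀ x z → z + 0 + 0 + (x + 0 + 0) + 0 ≡ x + z
  rearrange = solve-∀

transfer-01 : (F : ℕ → ℕ → ℕ) → transfer 0 1 F ≡ F 0 0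
transfer-01 F = rearrange (F 0 0)
  where
  rearrange : ∀ x → x + 0 + 0 + 0 ≡ x
  rearrange = solve-∀

tilingsWith-01 : (n : ℕ) → tilingsWith (1 + n) 0 1 ≡ A n
tilingsWith-01 zero    = refl
tilingsWith-01 (suc n) = begin
  tilingsWith (2 + n) 0 1                   ≡⟨ tilingsWith-transfer n 0 1 ⟩
  transfer 0 1 (tilingsWith (1 + n))        ≡⟨ transfer-01 (tilingsWith (1 + n)) ⟩
  tilingsWith (1 + n) 0 0                   ≡⟨ A-tilingsWith (1 + n) ⟨
  A (1 + n)                                 ∎
  where open ≡-Reasoning

theorem2p2 : (A 0 ≡ 1 × A 1 ≡ 1 × A 2 ≡ 3) × (∀ n → A (3 + n) ≡ A (2 + n) + 2 * A (1 + n) + A n)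
theorem2p2 = (refl , refl , refl) , recurrence
  where
  T : ℕ → ℕ → ℕ → ℕ
  T = tilingsWith
  recurrence : ∀ n → A (3 + n) ≡ A (2 + n) + 2 * A (1 + n) + A n
  recurrence n = begin
    A (3 + n)                                         ≡⟨ A-tilingsWith (3 + n) ⟩
    T (3 + n) 0 0                                     ≡⟨ tilingsWith-transfer (1 + n) 0 0 ⟩
    transfer 0 0 (T (2 + n))                          ≡⟨ transfer-00 (T (2 + n)) ⟩
    T (2 + n) 0 0 + T (2 + n) 1 0 + T (2 + n) 0 1
      ≡⟨ cong₂ (λ u v → T (2 + n) 0 0 + u + v)
               (≡.trans (tilingsWith-transfer n 1 0) (transfer-10 (T (1 + n))))
               (≡.trans (tilingsWith-transfer n 0 1) (transfer-01 (T (1 + n)))) ⟩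
    T (2 + n) 0 0 + (T (1 + n) 0 0 + T (1 + n) 0 1) + T (1 + n) 0 0
      ≡⟨ cong₂ (λ u v → u + (v + T (1 + n) 0 1) + v) (A-tilingsWith (2 + n)) (A-tilingsWith (1 + n)) ⟨
    A (2 + n) + (A (1 + n) + T (1 + n) 0 1) + A (1 + n)
      ≡⟨ cong (λ w → A (2 + n) + (A (1 + n) + w) + A (1 + n)) (tilingsWith-01 n) ⟩
    A (2 + n) + (A (1 + n) + A n) + A (1 + n)         ≡⟨ rearrange (A (2 + n)) (A (1 + n)) (A n) ⟩
    A (2 + n) + 2 * A (1 + n) + A n                   ∎
    where
    open ≡-Reasoning
    rearrange : ∀ x y z → x + (y + z) + y ≡ x + 2 * y + z
    rearrange = solve-∀
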